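{- For a triangle quadruple $Q$, let $\max(Q)$ denote its largest entry. Then the number of triangle quadruples $Q$ with $\max(Q)\le n$ is $O(n^2\log^3 n)$.
   Context: A triangle quadruple is a quadruple $(a,b,c,d)$ of nonnegative integers satisfying $3(a^2+b^2+c^2+d^2)=(a+b+c+d)^2$. -}

module Defs where

open import Data.Nat using (ℕ; suc; _+_; _*_; _^_; _≤_)
open import Data.Nat.Properties using (_≟_)
open import Data.Product using (_×_; _,_)
open import Data.List using (List; upTo; cartesianProduct; filter; length)
open import Relation.Binary.PropositionalEquality using (_≡_)
open import Relation.Nullary using (Dec)

IsTriangleQuadruple : ℕ × ℕ × ℕ × ℕ → Set
IsTriangleQuadruple (a , b , c , d) =
  3 * (a ^ 2 + b ^ 2 + c ^ 2 + d ^ 2) ≡ (a + b + c + d) ^ 2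

isTriangleQuadruple? : (q : ℕ × ℕ × ℕ × ℕ) → Dec (IsTriangleQuadruple q)
isTriangleQuadruple? (a , b , c , d) =
  3 * (a ^ 2 + b ^ 2 + c ^ 2 + d ^ 2) ≟ (a + b + c + d) ^ 2

boxQuadruples : ℕ → List (ℕ × ℕ × ℕ × ℕ)
boxQuadruples n =
  cartesianProduct r (cartesianProduct r (cartesianProduct r r))
  where r = upTo (suc n)

countTriangleQuadruples : ℕ → ℕ
countTriangleQuadruples n = length (filter isTriangleQuadruple? (boxQuadruples n))

{-# OPTIONS --safe #-}
module Submission where

-- Put r = (a − c + d) + (b − c)ω in the Eisenstein integers; the triangle equation
-- becomes 3a · d = N(r). A descent on 3a, reducing r modulo 3a as in Fermat's proof of
-- the two-squares theorem, factors r = λ α β̄ with 3a = λ N(α) and d = λ N(β), and the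
-- quadruple is read back from (λ, α, β). Since 4 N(x + yω) = (2y − x)² + 3x², every
-- coordinate of α and β has absolute value at most √(4n/λ), so scale λ contributes
-- O(n²/λ²) parameters, and Σ 1/(λ(λ + 1)) ≤ 1 bounds the count by 2592 n².

open import Defs

module EisensteinNorm where

  open import Data.Integer.Base using (ℤ; +_; -[1+_]; _+_; _-_; -_; _*_; ∣_∣)
  import Data.Integer.Properties as ℤP
  open import Data.Integer.DivMod using (_/ℕ_; _%ℕ_; a≡a%ℕn+[a/ℕn]*n; n%ℕd<d)
  open import Data.Integer.Tactic.RingSolver using (solve-∀)
  open import Data.Nat.Base as ℕ using (ℕ; zero; suc; NonZero; _<_; _≤_)
  import Data.Nat.Properties as ℕP
  import Data.Nat.Tactic.RingSolver as ℕ-Ring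
  open import Data.Nat.Induction using (<-wellFounded)
  open import Induction.WellFounded using (Acc; acc)
  open import Data.Product.Base using (_×_; _,_; ∃-syntax)
  open import Data.Sum.Base using (inj₁; inj₂; [_,_]′)
  open import Function.Base using (id)
  open import Relation.Binary.PropositionalEquality

  ∣_∣² : ℤ → ℕ
  ∣ x ∣² = ∣ x ∣ ℕ.* ∣ x ∣

  -- A pair (x, y) stands for the Eisenstein integer x + yω, where ω² + ω + 1 = 0:
  -- norm is its norm and mulConj₁, mulConj₂ are the coordinates of α β̄.
  -- The ring solver does not unfold these names, so identities about them are
  -- proved in expanded form.
  norm : ℤ → ℤ → ℤ
  norm x y = x * x - x * y + y * y

  mulConj₁ mulConj₂ : ℤ → ℤ → ℤ → ℤ → ℤ
  mulConj₁ a₁ a₂ b₁ b₂ = a₁ * b₁ - a₁ * b₂ + a₂ * b₂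
  mulConj₂ a₁ a₂ b₁ b₂ = a₂ * b₁ - a₁ * b₂

  polar : ℤ → ℤ → ℤ → ℤ → ℤ
  polar x y u v = + 2 * x * u - x * v - y * u + + 2 * y * v

  norm-sym : ∀ x y → norm x y ≡ norm y x
  norm-sym = identity
    where
    identity : ∀ x y → x * x - x * y + y * y ≡ y * y - y * x + x * x
    identity = solve-∀

  norm-conj : ∀ x y → norm (x - y) (- y) ≡ norm x y
  norm-conj = identity
    where
    identity : ∀ x y → (x - y) * (x - y) - (x - y) * (- y) + (- y) * (- y) ≡ x * x - x * y + y * y
    identity = solve-∀

  norm-shift : ∀ e₁ e₂ q₁ q₂ a →
    norm (e₁ + q₁ * a) (e₂ + q₂ * a) ≡ norm e₁ e₂ + a * polar e₁ e₂ q₁ q₂ + a * a * norm q₁ q₂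
  norm-shift = identity
    where
    identity : ∀ e₁ e₂ q₁ q₂ a →
      (e₁ + q₁ * a) * (e₁ + q₁ * a) - (e₁ + q₁ * a) * (e₂ + q₂ * a) + (e₂ + q₂ * a) * (e₂ + q₂ * a)
      ≡ (e₁ * e₁ - e₁ * e₂ + e₂ * e₂) + a * (+ 2 * e₁ * q₁ - e₁ * q₂ - e₂ * q₁ + + 2 * e₂ * q₂)
        + a * a * (q₁ * q₁ - q₁ * q₂ + q₂ * q₂)
    identity = solve-∀

  norm-mulConj : ∀ l a₁ a₂ b₁ b₂ →
    norm (l * mulConj₁ a₁ a₂ b₁ b₂) (l * mulConj₂ a₁ a₂ b₁ b₂) ≡ l * norm a₁ a₂ * (l * norm b₁ b₂)
  norm-mulConj = identity
    where
    identity : ∀ l a₁ a₂ b₁ b₂ →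
      (l * (a₁ * b₁ - a₁ * b₂ + a₂ * b₂)) * (l * (a₁ * b₁ - a₁ * b₂ + a₂ * b₂))
      - (l * (a₁ * b₁ - a₁ * b₂ + a₂ * b₂)) * (l * (a₂ * b₁ - a₁ * b₂))
      + (l * (a₂ * b₁ - a₁ * b₂)) * (l * (a₂ * b₁ - a₁ * b₂))
      ≡ l * (a₁ * a₁ - a₁ * a₂ + a₂ * a₂) * (l * (b₁ * b₁ - b₁ * b₂ + b₂ * b₂))
    identity = solve-∀

  sq≡∣∣² : ∀ i → i * i ≡ + ∣ i ∣²
  sq≡∣∣² (+ n)    = sym (ℤP.pos-* n n)
  sq≡∣∣² -[1+ n ] = refl

  four-norm : ∀ x y → + 4 * norm x y ≡ + (∣ + 2 * y - x ∣² ℕ.+ 3 ℕ.* ∣ x ∣²)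
  four-norm x y = begin
    + 4 * norm x y                                  ≡⟨ identity x y ⟩
    (+ 2 * y - x) * (+ 2 * y - x) + + 3 * (x * x)   ≡⟨ cong₂ (λ u v → u + + 3 * v) (sq≡∣∣² (+ 2 * y - x)) (sq≡∣∣² x) ⟩
    + ∣ + 2 * y - x ∣² + + 3 * + ∣ x ∣²              ≡⟨ cong (_+_ (+ ∣ + 2 * y - x ∣²)) (sym (ℤP.pos-* 3 ∣ x ∣²)) ⟩
    + ∣ + 2 * y - x ∣² + + (3 ℕ.* ∣ x ∣²)            ≡⟨ sym (ℤP.pos-+ ∣ + 2 * y - x ∣² (3 ℕ.* ∣ x ∣²)) ⟩
    + (∣ + 2 * y - x ∣² ℕ.+ 3 ℕ.* ∣ x ∣²)            ∎
    where
    open ≡-Reasoning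
    identity : ∀ x y → + 4 * (x * x - x * y + y * y) ≡ (+ 2 * y - x) * (+ 2 * y - x) + + 3 * (x * x)
    identity = solve-∀

  ∣∣²≡0⇒≡0 : ∀ x → ∣ x ∣² ≡ 0 → x ≡ + 0
  ∣∣²≡0⇒≡0 x ∣x∣²≡0 = ℤP.∣i∣≡0⇒i≡0 ([ id , id ]′ (ℕP.m*n≡0⇒m≡0∨n≡0 ∣ x ∣ ∣x∣²≡0))

  norm≡0⇒≡0 : ∀ x y → norm x y ≡ + 0 → x ≡ + 0
  norm≡0⇒≡0 x y N≡0 = ∣∣²≡0⇒≡0 x (ℕP.m+n≡0⇒m≡0 ∣ x ∣² (ℕP.m+n≡0⇒n≡0 ∣ + 2 * y - x ∣² 4N≡0))
    where
    4N≡0 : ∣ + 2 * y - x ∣² ℕ.+ 3 ℕ.* ∣ x ∣² ≡ 0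
    4N≡0 = ℤP.+-injective (trans (sym (four-norm x y)) (cong (+ 4 *_) N≡0))

  four-scaled-norm : ∀ X l x y → + X ≡ + l * norm x y →
                     4 ℕ.* X ≡ l ℕ.* (∣ + 2 * y - x ∣² ℕ.+ 3 ℕ.* ∣ x ∣²)
  four-scaled-norm X l x y X≡ = ℤP.+-injective (begin
    + (4 ℕ.* X)                 ≡⟨ ℤP.pos-* 4 X ⟩
    + 4 * + X                   ≡⟨ cong (+ 4 *_) X≡ ⟩
    + 4 * (+ l * norm x y)      ≡⟨ ℤP.*-assoc (+ 4) (+ l) (norm x y) ⟨
    + 4 * + l * norm x y        ≡⟨ cong (_* norm x y) (ℤP.*-comm (+ 4) (+ l)) ⟩
    + l * + 4 * norm x y        ≡⟨ ℤP.*-assoc (+ l) (+ 4) (norm x y) ⟩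
    + l * (+ 4 * norm x y)      ≡⟨ cong (+ l *_) (four-norm x y) ⟩
    + l * + (U ℕ.+ 3 ℕ.* ∣ x ∣²) ≡⟨ ℤP.pos-* l (U ℕ.+ 3 ℕ.* ∣ x ∣²) ⟨
    + (l ℕ.* (U ℕ.+ 3 ℕ.* ∣ x ∣²)) ∎)
    where
    open ≡-Reasoning
    U = ∣ + 2 * y - x ∣²

  scaled-norm-bound : ∀ X l x y → + X ≡ + l * norm x y → l ℕ.* ∣ x ∣² ℕ.* 3 ≤ 4 ℕ.* X
  scaled-norm-bound X l x y X≡ = begin
    l ℕ.* ∣ x ∣² ℕ.* 3         ≡⟨ reorder l ∣ x ∣² ⟩
    l ℕ.* (3 ℕ.* ∣ x ∣²)       ≤⟨ ℕP.*-monoʳ-≤ l (ℕP.m≤n+m (3 ℕ.* ∣ x ∣²) ∣ + 2 * y - x ∣²) ⟩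
    l ℕ.* (∣ + 2 * y - x ∣² ℕ.+ 3 ℕ.* ∣ x ∣²) ≡⟨ four-scaled-norm X l x y X≡ ⟨
    4 ℕ.* X                    ∎
    where
    open ℕP.≤-Reasoning
    reorder : ∀ l v → l ℕ.* v ℕ.* 3 ≡ l ℕ.* (3 ℕ.* v)
    reorder = ℕ-Ring.solve-∀

  norm-ordered : ∀ x t → norm (+ x) (+ (x ℕ.+ t)) ≡ + (x ℕ.* x ℕ.+ x ℕ.* t ℕ.+ t ℕ.* t)
  norm-ordered x t = begin
    norm (+ x) (+ (x ℕ.+ t))                  ≡⟨ cong (norm (+ x)) (ℤP.pos-+ x t) ⟩
    norm (+ x) (+ x + + t)                    ≡⟨ identity (+ x) (+ t) ⟩
    + x * + x + + x * + t + + t * + t         ≡⟨ cong₂ (λ u v → u + v + + t * + t) (ℤP.pos-* x x) (ℤP.pos-* x t) ⟨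
    + (x ℕ.* x) + + (x ℕ.* t) + + t * + t     ≡⟨ cong₂ _+_ (ℤP.pos-+ (x ℕ.* x) (x ℕ.* t)) (ℤP.pos-* t t) ⟨
    + (x ℕ.* x ℕ.+ x ℕ.* t) + + (t ℕ.* t)     ≡⟨ ℤP.pos-+ (x ℕ.* x ℕ.+ x ℕ.* t) (t ℕ.* t) ⟨
    + (x ℕ.* x ℕ.+ x ℕ.* t ℕ.+ t ℕ.* t)       ∎
    where
    open ≡-Reasoning
    identity : ∀ x t → x * x - x * (x + t) + (x + t) * (x + t) ≡ x * x + x * t + t * t
    identity = solve-∀

  norm-below-square : ∀ {A} x y → x ≤ y → y < A → ∃[ m ] norm (+ x) (+ y) ≡ + m × m < A ℕ.* A
  norm-below-square {A} x y x≤y y<A = m , subst (λ w → norm (+ x) (+ w) ≡ + m) x+t≡y (norm-ordered x t) , m<A²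
    where
    open ℕP.≤-Reasoning
    t = y ℕ.∸ x
    m = x ℕ.* x ℕ.+ x ℕ.* t ℕ.+ t ℕ.* t
    x+t≡y : x ℕ.+ t ≡ y
    x+t≡y = ℕP.m+[n∸m]≡n x≤y
    square-split : ∀ x t → (x ℕ.+ t) ℕ.* (x ℕ.+ t) ≡ x ℕ.* x ℕ.+ x ℕ.* t ℕ.+ t ℕ.* t ℕ.+ x ℕ.* t
    square-split = ℕ-Ring.solve-∀
    m<A² : m < A ℕ.* A
    m<A² = begin-strict
      m                          ≤⟨ ℕP.m≤m+n m (x ℕ.* t) ⟩
      m ℕ.+ x ℕ.* t              ≡⟨ square-split x t ⟨
      (x ℕ.+ t) ℕ.* (x ℕ.+ t)    ≡⟨ cong (λ w → w ℕ.* w) x+t≡y ⟩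
      y ℕ.* y                    <⟨ ℕP.*-mono-< y<A y<A ⟩
      A ℕ.* A                    ∎

  norm-of-residues : ∀ {A} x y → x < A → y < A → ∃[ m ] norm (+ x) (+ y) ≡ + m × m < A ℕ.* A
  norm-of-residues x y x<A y<A with ℕP.≤-total x y
  ... | inj₁ x≤y = norm-below-square x y x≤y y<A
  ... | inj₂ y≤x with norm-below-square y x y≤x x<A
  ...   | m , N≡m , m<A² = m , trans (norm-sym (+ x) (+ y)) N≡m , m<A²

  cofactor-below : ∀ A z m → + A * z ≡ + m → m < A ℕ.* A → ∃[ k ] z ≡ + k × k < A
  cofactor-below zero    z        m _     ()
  cofactor-below A@(suc _) (+ k) m Ak≡m m<A² =
    k , refl , ℕP.*-cancelˡ-< A k A (subst (_< A ℕ.* A) (sym (ℤP.+-injective (trans (ℤP.pos-* A k) Ak≡m))) m<A²)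
  cofactor-below (suc _) -[1+ _ ] m ()

  cofactor-of-residues : ∀ {A} z x y → x < A → y < A → + A * z ≡ norm (+ x) (+ y) → ∃[ k ] z ≡ + k × k < A
  cofactor-of-residues {A} z x y x<A y<A Az≡N with norm-of-residues x y x<A y<A
  ... | m , N≡m , m<A² = cofactor-below A z m (trans Az≡N N≡m) m<A²

  cofactor-equation : ∀ a d e t n → a * d ≡ e + a * t + a * a * n → a * (d - t - a * n) ≡ e
  cofactor-equation a d e t n ad≡ = begin
    a * (d - t - a * n)                              ≡⟨ expand a d t n ⟩
    a * d - a * t - a * a * n                        ≡⟨ cong (λ u → u - a * t - a * a * n) ad≡ ⟩
    e + a * t + a * a * n - a * t - a * a * n        ≡⟨ cancel e (a * t) (a * a * n) ⟩
    e                                                ∎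
    where
    open ≡-Reasoning
    expand : ∀ a d t n → a * (d - t - a * n) ≡ a * d - a * t - a * a * n
    expand = solve-∀
    cancel : ∀ e u v → e + u + v - u - v ≡ e
    cancel = solve-∀

  record Factorisation (A D : ℕ) (r₁ r₂ : ℤ) : Set where
    constructor factorisation
    field
      scale       : ℕ
      a₁ a₂ b₁ b₂ : ℤ
      A≡ : + A ≡ + scale * norm a₁ a₂
      D≡ : + D ≡ + scale * norm b₁ b₂
      r₁≡ : r₁ ≡ + scale * mulConj₁ a₁ a₂ b₁ b₂
      r₂≡ : r₂ ≡ + scale * mulConj₂ a₁ a₂ b₁ b₂

  -- If ē = λ a b̄ and A = λ N(b), then c = a + q̄ b satisfies e + q A = λ b c̄.
  lift : ∀ {k A D} .{{_ : NonZero A}} e₁ e₂ q₁ q₂ →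
         + A * + D ≡ norm (e₁ + q₁ * + A) (e₂ + q₂ * + A) →
         Factorisation k A (e₁ - e₂) (- e₂) →
         Factorisation A D (e₁ + q₁ * + A) (e₂ + q₂ * + A)
  lift {A = A} {D} e₁ e₂ q₁ q₂ AD≡N (factorisation l a₁ a₂ b₁ b₂ _ A≡ ē₁≡ ē₂≡) =
    factorisation l b₁ b₂ c₁ c₂ A≡ D≡ r₁≡ r₂≡
    where
    open ≡-Reasoning
    L = + l
    c₁ = a₁ + (q₁ - q₂) * b₁ + q₂ * b₂
    c₂ = a₂ + q₁ * b₂ - q₂ * b₁
    r₁≡ : e₁ + q₁ * + A ≡ L * mulConj₁ b₁ b₂ c₁ c₂
    r₁≡ = begin
      e₁ + q₁ * + A                              ≡⟨ cong₂ (λ u v → u + q₁ * v) (unconj e₁ e₂) A≡ ⟩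
      (e₁ - e₂) - (- e₂) + q₁ * (L * norm b₁ b₂) ≡⟨ cong (λ u → u + q₁ * (L * norm b₁ b₂)) (cong₂ _-_ ē₁≡ ē₂≡) ⟩
      L * mulConj₁ a₁ a₂ b₁ b₂ - L * mulConj₂ a₁ a₂ b₁ b₂ + q₁ * (L * norm b₁ b₂) ≡⟨ identity L a₁ a₂ b₁ b₂ q₁ q₂ ⟩
      L * mulConj₁ b₁ b₂ c₁ c₂                   ∎
      where
      unconj : ∀ u v → u ≡ (u - v) - (- v)
      unconj = solve-∀
      identity : ∀ L a₁ a₂ b₁ b₂ q₁ q₂ →
        L * (a₁ * b₁ - a₁ * b₂ + a₂ * b₂) - L * (a₂ * b₁ - a₁ * b₂) + q₁ * (L * (b₁ * b₁ - b₁ * b₂ + b₂ * b₂))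
        ≡ L * (b₁ * (a₁ + (q₁ - q₂) * b₁ + q₂ * b₂) - b₁ * (a₂ + q₁ * b₂ - q₂ * b₁) + b₂ * (a₂ + q₁ * b₂ - q₂ * b₁))
      identity = solve-∀
    r₂≡ : e₂ + q₂ * + A ≡ L * mulConj₂ b₁ b₂ c₁ c₂
    r₂≡ = begin
      e₂ + q₂ * + A                              ≡⟨ cong₂ (λ u v → u + q₂ * v) (sym (ℤP.neg-involutive e₂)) A≡ ⟩
      - (- e₂) + q₂ * (L * norm b₁ b₂)           ≡⟨ cong (λ u → - u + q₂ * (L * norm b₁ b₂)) ē₂≡ ⟩
      - (L * mulConj₂ a₁ a₂ b₁ b₂) + q₂ * (L * norm b₁ b₂) ≡⟨ identity L a₁ a₂ b₁ b₂ q₁ q₂ ⟩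
      L * mulConj₂ b₁ b₂ c₁ c₂                   ∎
      where
      identity : ∀ L a₁ a₂ b₁ b₂ q₁ q₂ →
        - (L * (a₂ * b₁ - a₁ * b₂)) + q₂ * (L * (b₁ * b₁ - b₁ * b₂ + b₂ * b₂))
        ≡ L * (b₂ * (a₁ + (q₁ - q₂) * b₁ + q₂ * b₂) - b₁ * (a₂ + q₁ * b₂ - q₂ * b₁))
      identity = solve-∀
    D≡ : + D ≡ L * norm c₁ c₂
    D≡ = ℤP.*-cancelˡ-≡ (+ A) (+ D) (L * norm c₁ c₂) (begin
      + A * + D                                        ≡⟨ AD≡N ⟩
      norm (e₁ + q₁ * + A) (e₂ + q₂ * + A)             ≡⟨ cong₂ norm r₁≡ r₂≡ ⟩
      norm (L * mulConj₁ b₁ b₂ c₁ c₂) (L * mulConj₂ b₁ b₂ c₁ c₂) ≡⟨ norm-mulConj L b₁ b₂ c₁ c₂ ⟩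
      L * norm b₁ b₂ * (L * norm c₁ c₂)                ≡⟨ cong (_* (L * norm c₁ c₂)) A≡ ⟨
      + A * (L * norm c₁ c₂)                           ∎)

  -- Reducing r modulo A leaves e with N(e) = A k and k < A; the conjugate ē is the
  -- smaller instance.
  descent : ∀ A → Acc _<_ A → ∀ D r₁ r₂ → + A * + D ≡ norm r₁ r₂ → Factorisation A D r₁ r₂
  descent zero _ D r₁ r₂ 0≡N =
    factorisation D (+ 0) (+ 0) (+ 1) (+ 0) (sym (ℤP.*-zeroʳ (+ D))) (sym (ℤP.*-identityʳ (+ D)))
      (trans r₁≡0 (sym (ℤP.*-zeroʳ (+ D)))) (trans r₂≡0 (sym (ℤP.*-zeroʳ (+ D))))
    where
    r₁≡0 : r₁ ≡ + 0
    r₁≡0 = norm≡0⇒≡0 r₁ r₂ (sym 0≡N)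
    r₂≡0 : r₂ ≡ + 0
    r₂≡0 = norm≡0⇒≡0 r₂ r₁ (trans (norm-sym r₂ r₁) (sym 0≡N))
  descent A@(suc _) (acc smaller) D r₁ r₂ AD≡N =
    subst₂ (Factorisation A D) (sym r₁≡) (sym r₂≡)
      (lifted (cofactor-of-residues cofactor (r₁ %ℕ A) (r₂ %ℕ A) (n%ℕd<d r₁ A) (n%ℕd<d r₂ A) A*cofactor≡N))
    where
    open ≡-Reasoning
    e₁ = + (r₁ %ℕ A)
    e₂ = + (r₂ %ℕ A)
    q₁ = r₁ /ℕ A
    q₂ = r₂ /ℕ A
    r₁≡ : r₁ ≡ e₁ + q₁ * + A
    r₁≡ = a≡a%ℕn+[a/ℕn]*n r₁ A
    r₂≡ : r₂ ≡ e₂ + q₂ * + A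
    r₂≡ = a≡a%ℕn+[a/ℕn]*n r₂ A
    AD≡N′ : + A * + D ≡ norm (e₁ + q₁ * + A) (e₂ + q₂ * + A)
    AD≡N′ = trans AD≡N (cong₂ norm r₁≡ r₂≡)
    cofactor = + D - polar e₁ e₂ q₁ q₂ - + A * norm q₁ q₂
    A*cofactor≡N : + A * cofactor ≡ norm e₁ e₂
    A*cofactor≡N = cofactor-equation (+ A) (+ D) (norm e₁ e₂) (polar e₁ e₂ q₁ q₂) (norm q₁ q₂)
                     (trans AD≡N′ (norm-shift e₁ e₂ q₁ q₂ (+ A)))
    lifted : ∃[ k ] cofactor ≡ + k × k < A → Factorisation A D (e₁ + q₁ * + A) (e₂ + q₂ * + A)
    lifted (k , cofactor≡k , k<A) = lift e₁ e₂ q₁ q₂ AD≡N′ (descent k (smaller k<A) A (e₁ - e₂) (- e₂) kA≡N)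
      where
      kA≡N : + k * + A ≡ norm (e₁ - e₂) (- e₂)
      kA≡N = begin
        + k * + A              ≡⟨ ℤP.*-comm (+ k) (+ A) ⟩
        + A * + k              ≡⟨ cong (+ A *_) cofactor≡k ⟨
        + A * cofactor         ≡⟨ A*cofactor≡N ⟩
        norm e₁ e₂             ≡⟨ norm-conj e₁ e₂ ⟨
        norm (e₁ - e₂) (- e₂)  ∎

  factorise : ∀ A D r₁ r₂ → + A * + D ≡ norm r₁ r₂ → Factorisation A D r₁ r₂
  factorise A = descent A (<-wellFounded A)

module Parametrisation where

  open EisensteinNorm
  open import Data.Integer.Base using (ℤ; +_; _+_; _-_; _*_; ∣_∣)
  import Data.Integer.Properties as ℤP
  open import Data.Integer.Tactic.RingSolver using (solve-∀)
  open import Data.Nat.Base as ℕ using (ℕ; _≤_; _/_)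
  import Data.Nat.Properties as ℕP
  open import Data.Nat.DivMod using (m*n/n≡m)
  open import Data.Product.Base using (_×_; _,_; ∃-syntax; proj₁; proj₂)
  open import Relation.Binary.PropositionalEquality

  pos-+₄ : ∀ a b c d → + (a ℕ.+ b ℕ.+ c ℕ.+ d) ≡ + a + + b + + c + + d
  pos-+₄ a b c d
    rewrite ℤP.pos-+ (a ℕ.+ b ℕ.+ c) d | ℤP.pos-+ (a ℕ.+ b) c | ℤP.pos-+ a b = refl

  pos-² : ∀ x → + (x ℕ.^ 2) ≡ + x * + x
  pos-² x rewrite ℕP.*-identityʳ x = ℤP.pos-* x x

  triangle-norm : ∀ a b c d → IsTriangleQuadruple (a , b , c , d) →
                  + (a ℕ.* 3) * + d ≡ norm (+ a - + c + + d) (+ b - + c)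
  triangle-norm a b c d isT = sym (ℤP.*-cancelˡ-≡ (+ 2) _ _ (begin
    + 2 * norm (A - C + D) (B - C)                    ≡⟨ identity A B C D ⟩
    + 2 * (+ 3 * A * D) + (+ 3 * Σsq - S * S)         ≡⟨ cong (λ u → + 2 * (+ 3 * A * D) + (u - S * S)) 3Σsq≡S² ⟩
    + 2 * (+ 3 * A * D) + (S * S - S * S)             ≡⟨ cong (_+_ (+ 2 * (+ 3 * A * D))) (ℤP.+-inverseʳ (S * S)) ⟩
    + 2 * (+ 3 * A * D) + + 0                         ≡⟨ ℤP.+-identityʳ (+ 2 * (+ 3 * A * D)) ⟩
    + 2 * (+ 3 * A * D)                               ≡⟨ cong (λ u → + 2 * (u * D)) (trans (ℤP.pos-* a 3) (ℤP.*-comm A (+ 3))) ⟨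
    + 2 * (+ (a ℕ.* 3) * D)                           ∎))
    where
    open ≡-Reasoning
    A = + a
    B = + b
    C = + c
    D = + d
    Σsq = A * A + B * B + C * C + D * D
    S = A + B + C + D
    3Σsq≡S² : + 3 * Σsq ≡ S * S
    3Σsq≡S²
      rewrite sym (pos-² a) | sym (pos-² b) | sym (pos-² c) | sym (pos-² d)
            | sym (pos-+₄ (a ℕ.^ 2) (b ℕ.^ 2) (c ℕ.^ 2) (d ℕ.^ 2)) | sym (pos-+₄ a b c d)
            | sym (ℤP.pos-* 3 (a ℕ.^ 2 ℕ.+ b ℕ.^ 2 ℕ.+ c ℕ.^ 2 ℕ.+ d ℕ.^ 2))
            | sym (pos-² (a ℕ.+ b ℕ.+ c ℕ.+ d)) = cong +_ isT
    identity : ∀ A B C D →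
      + 2 * ((A - C + D) * (A - C + D) - (A - C + D) * (B - C) + (B - C) * (B - C))
      ≡ + 2 * (+ 3 * A * D) + (+ 3 * (A * A + B * B + C * C + D * D) - (A + B + C + D) * (A + B + C + D))
    identity = solve-∀

  Parameter : Set
  Parameter = ℕ × ℤ × ℤ × ℤ × ℤ

  entries : Parameter → ℤ × ℤ × ℤ × ℤ
  entries (l , a₁ , a₂ , b₁ , b₂) =
    + l * norm a₁ a₂ , + l * norm b₁ b₂ , + l * mulConj₁ a₁ a₂ b₁ b₂ , + l * mulConj₂ a₁ a₂ b₁ b₂

  decode : ℤ × ℤ × ℤ × ℤ → ℕ × ℕ × ℕ × ℕ
  decode (A , D , r₁ , r₂) = a , ∣ r₂ + + c ∣ , c , ∣ D ∣
    where
    a = ∣ A ∣ / 3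
    c = ∣ + a + D - r₁ ∣

  a+d-[a-c+d]≡c : ∀ a c d → a + d - (a - c + d) ≡ c
  a+d-[a-c+d]≡c = solve-∀

  b-c+c≡b : ∀ b c → b - c + c ≡ b
  b-c+c≡b = solve-∀

  decode-triangle : ∀ a b c d → decode (+ (a ℕ.* 3) , + d , + a - + c + + d , + b - + c) ≡ (a , b , c , d)
  decode-triangle a b c d
    rewrite m*n/n≡m a 3 ⦃ _ ⦄ | a+d-[a-c+d]≡c (+ a) (+ c) (+ d) | b-c+c≡b (+ b) (+ c) = refl

  Bounded : ℕ → Parameter → Set
  Bounded K (l , a₁ , a₂ , b₁ , b₂) =
    l ℕ.* ∣ a₁ ∣² ≤ K × l ℕ.* ∣ a₂ ∣² ≤ K × l ℕ.* ∣ b₁ ∣² ≤ K × l ℕ.* ∣ b₂ ∣² ≤ K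

  coordinate-bound : ∀ n X l x y → X ≤ n ℕ.* 3 → + X ≡ + l * norm x y → l ℕ.* ∣ x ∣² ≤ 4 ℕ.* n
  coordinate-bound n X l x y X≤3n X≡ = ℕP.*-cancelʳ-≤ (l ℕ.* ∣ x ∣²) (4 ℕ.* n) 3 (begin
    l ℕ.* ∣ x ∣² ℕ.* 3 ≤⟨ scaled-norm-bound X l x y X≡ ⟩
    4 ℕ.* X            ≤⟨ ℕP.*-monoʳ-≤ 4 X≤3n ⟩
    4 ℕ.* (n ℕ.* 3)    ≡⟨ ℕP.*-assoc 4 n 3 ⟨
    4 ℕ.* n ℕ.* 3      ∎)
    where open ℕP.≤-Reasoning

  coordinate-bounds : ∀ n X l x y → X ≤ n ℕ.* 3 → + X ≡ + l * norm x y →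
                        l ℕ.* ∣ x ∣² ≤ 4 ℕ.* n × l ℕ.* ∣ y ∣² ≤ 4 ℕ.* n
  coordinate-bounds n X l x y X≤3n X≡ =
    coordinate-bound n X l x y X≤3n X≡ ,
    coordinate-bound n X l y x X≤3n (trans X≡ (cong (+ l *_) (norm-sym x y)))

  triangle-parameter : ∀ n a b c d → a ≤ n → d ≤ n → IsTriangleQuadruple (a , b , c , d) →
                       ∃[ p ] Bounded (4 ℕ.* n) p × decode (entries p) ≡ (a , b , c , d)
  triangle-parameter n a b c d a≤n d≤n isT =
    (scale , a₁ , a₂ , b₁ , b₂) , (a-bounds .proj₁ , a-bounds .proj₂ , b-bounds .proj₁ , b-bounds .proj₂) ,
    trans (cong decode entries≡) (decode-triangle a b c d)
    where
    open Factorisation (factorise (a ℕ.* 3) d (+ a - + c + + d) (+ b - + c) (triangle-norm a b c d isT))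
    a-bounds : scale ℕ.* ∣ a₁ ∣² ≤ 4 ℕ.* n × scale ℕ.* ∣ a₂ ∣² ≤ 4 ℕ.* n
    a-bounds = coordinate-bounds n (a ℕ.* 3) scale a₁ a₂ (ℕP.*-monoˡ-≤ 3 a≤n) A≡
    b-bounds : scale ℕ.* ∣ b₁ ∣² ≤ 4 ℕ.* n × scale ℕ.* ∣ b₂ ∣² ≤ 4 ℕ.* n
    b-bounds = coordinate-bounds n d scale b₁ b₂ (ℕP.≤-trans d≤n (ℕP.m≤m*n n 3)) D≡
    entries≡ : entries (scale , a₁ , a₂ , b₁ , b₂) ≡ (+ (a ℕ.* 3) , + d , + a - + c + + d , + b - + c)
    entries≡ = sym (cong₂ _,_ A≡ (cong₂ _,_ D≡ (cong₂ _,_ r₁≡ r₂≡)))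

open import Data.Nat.Base using (ℕ; zero; suc; _+_; _*_; _^_; _≤_; _<_; _/_; z≤n; s≤s; NonZero)
open import Data.Nat.Properties
open import Data.Nat.DivMod using (m*n/n≡m; /-monoˡ-≤; m/n*n≤m; m/n/o≡m/[n*o]; n/1≡n; m≥n⇒m/n>0)
import Data.Nat.Tactic.RingSolver as ℕ-Ring
open import Data.Nat.Logarithm using (⌊log₂_⌋; ⌊log₂⌋-mono-≤)
open import Data.Integer.Base as ℤ using (ℤ; +_; -[1+_]; ∣_∣)
import Data.Integer.Properties as ℤP
open import Data.List.Base using (List; []; _∷_; length; map; _++_; upTo; cartesianProduct; filter)
open import Data.List.Properties using (length-++; length-map; length-upTo; length-removeAt′)
open import Data.List.Membership.Propositional using (_∈_)
open import Data.List.Membership.Propositional.Properties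
  using (∈-map⁺; ∈-++⁺ˡ; ∈-++⁺ʳ; ∈-upTo⁺; ∈-upTo⁻; ∈-cartesianProduct⁺; ∈-cartesianProduct⁻; ∈-filter⁻)
open import Data.List.Relation.Unary.Any using (here; there; index; _─_)
open import Data.List.Relation.Unary.All as All using ()
open import Data.List.Relation.Unary.AllPairs using ([]; _∷_)
open import Data.List.Relation.Unary.Unique.Propositional using (Unique)
import Data.List.Relation.Unary.Unique.Propositional.Properties as Unique
open import Data.List.Relation.Binary.Subset.Propositional using (_⊆_)
open import Data.Product.Base using (_×_; _,_; proj₁; proj₂; ∃-syntax)
open import Data.Sum.Base using (inj₁; inj₂)
open import Function.Base using (_∘_)
open import Relation.Nullary using (yes; no; contradiction)
open import Relation.Binary.PropositionalEquality

open EisensteinNorm using (∣_∣²; ∣∣²≡0⇒≡0)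
open Parametrisation using (Parameter; entries; decode; Bounded; triangle-parameter)

module _ {A : Set} where

  ∈-─ : ∀ {x z : A} {ys} (p : x ∈ ys) → z ∈ ys → z ≢ x → z ∈ (ys ─ p)
  ∈-─ (here refl) (here refl) z≢x = contradiction refl z≢x
  ∈-─ (here refl) (there z∈ys) _  = z∈ys
  ∈-─ (there p)   (here refl)  _  = here refl
  ∈-─ (there p)   (there z∈ys) z≢x = there (∈-─ p z∈ys z≢x)

  Unique-⊆⇒length≤ : ∀ {xs ys : List A} → Unique xs → xs ⊆ ys → length xs ≤ length ys
  Unique-⊆⇒length≤ {[]}     _                _        = z≤n
  Unique-⊆⇒length≤ {x ∷ xs} {ys} (x∉xs ∷ unique) x∷xs⊆ys = begin
    suc (length xs)          ≤⟨ s≤s (Unique-⊆⇒length≤ unique xs⊆ys─x) ⟩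
    suc (length (ys ─ x∈ys)) ≡⟨ length-removeAt′ ys (index x∈ys) ⟨
    length ys                ∎
    where
    open ≤-Reasoning
    x∈ys : x ∈ ys
    x∈ys = x∷xs⊆ys (here refl)
    xs⊆ys─x : xs ⊆ (ys ─ x∈ys)
    xs⊆ys─x z∈xs = ∈-─ x∈ys (x∷xs⊆ys (there z∈xs)) (λ z≡x → All.lookup x∉xs z∈xs (sym z≡x))

length-cartesianProduct : ∀ {A B : Set} (xs : List A) (ys : List B) →
                          length (cartesianProduct xs ys) ≡ length xs * length ys
length-cartesianProduct []       ys = refl
length-cartesianProduct (x ∷ xs) ys = begin
  length (map (x ,_) ys ++ cartesianProduct xs ys)          ≡⟨ length-++ (map (x ,_) ys) ⟩
  length (map (x ,_) ys) + length (cartesianProduct xs ys)  ≡⟨ cong₂ _+_ (length-map (x ,_) ys) (length-cartesianProduct xs ys) ⟩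
  length ys + length xs * length ys                         ∎
  where open ≡-Reasoning

m*n≤o⇒m≤o/n : ∀ m n o .{{_ : NonZero n}} → m * n ≤ o → m ≤ o / n
m*n≤o⇒m≤o/n m n o mn≤o = subst (_≤ o / n) (m*n/n≡m m n) (/-monoˡ-≤ n mn≤o)

⌊√_⌋ : ℕ → ℕ
⌊√ zero ⌋  = 0
⌊√ suc m ⌋ with suc ⌊√ m ⌋ * suc ⌊√ m ⌋ ≤? suc m
... | yes _ = suc ⌊√ m ⌋
... | no  _ = ⌊√ m ⌋

⌊√⌋-spec : ∀ m → ⌊√ m ⌋ * ⌊√ m ⌋ ≤ m × m < suc ⌊√ m ⌋ * suc ⌊√ m ⌋
⌊√⌋-spec zero = z≤n , s≤s z≤n
⌊√⌋-spec (suc m) with suc ⌊√ m ⌋ * suc ⌊√ m ⌋ ≤? suc m | ⌊√⌋-spec m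
... | yes r′²≤1+m | _ , m<r′² = r′²≤1+m , ≤-<-trans m<r′² (*-mono-< (n<1+n (suc ⌊√ m ⌋)) (n<1+n (suc ⌊√ m ⌋)))
... | no  r′²≰1+m | r²≤m , _  = ≤-trans r²≤m (n≤1+n m) , ≰⇒> r′²≰1+m

⌊√⌋-greatest : ∀ m x → x * x ≤ m → x ≤ ⌊√ m ⌋
⌊√⌋-greatest m x x²≤m = ≮⇒≥ λ r<x →
  n≮n m (<-≤-trans (proj₂ (⌊√⌋-spec m)) (≤-trans (*-mono-≤ r<x r<x) x²≤m))

ball : ℕ → List ℤ
ball r = map (ℤ.+_) (upTo (suc r)) ++ map -[1+_] (upTo r)

∈-ball : ∀ r x → ∣ x ∣ ≤ r → x ∈ ball r
∈-ball r (+ k)    k≤r = ∈-++⁺ˡ (∈-map⁺ (ℤ.+_) (∈-upTo⁺ (s≤s k≤r)))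
∈-ball r -[1+ k ] k<r = ∈-++⁺ʳ (map (ℤ.+_) (upTo (suc r))) (∈-map⁺ -[1+_] (∈-upTo⁺ k<r))

length-ball : ∀ r → length (ball r) ≡ suc r + r
length-ball r = begin
  length (map (ℤ.+_) (upTo (suc r)) ++ map -[1+_] (upTo r))        ≡⟨ length-++ (map (ℤ.+_) (upTo (suc r))) ⟩
  length (map (ℤ.+_) (upTo (suc r))) + length (map -[1+_] (upTo r)) ≡⟨ cong₂ _+_ (length-upTo⁺ (ℤ.+_) (suc r)) (length-upTo⁺ -[1+_] r) ⟩
  suc r + r                                                        ∎
  where
  open ≡-Reasoning
  length-upTo⁺ : ∀ (f : ℕ → ℤ) n → length (map f (upTo n)) ≡ n
  length-upTo⁺ f n = trans (length-map f (upTo n)) (length-upTo n)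

ball⁴ : ℕ → List (ℤ × ℤ × ℤ × ℤ)
ball⁴ r = cartesianProduct (ball r) (cartesianProduct (ball r) (cartesianProduct (ball r) (ball r)))

∈-ball⁴ : ∀ r {a₁ a₂ b₁ b₂} → a₁ ∈ ball r → a₂ ∈ ball r → b₁ ∈ ball r → b₂ ∈ ball r →
          (a₁ , a₂ , b₁ , b₂) ∈ ball⁴ r
∈-ball⁴ r a₁∈ a₂∈ b₁∈ b₂∈ = ∈-cartesianProduct⁺ a₁∈ (∈-cartesianProduct⁺ a₂∈ (∈-cartesianProduct⁺ b₁∈ b₂∈))

length-ball⁴ : ∀ r → length (ball⁴ r) ≡ (suc r + r) * ((suc r + r) * ((suc r + r) * (suc r + r)))
length-ball⁴ r = begin
  length (ball⁴ r)                                   ≡⟨ length-cartesianProduct (ball r) (cartesianProduct (ball r) (cartesianProduct (ball r) (ball r))) ⟩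
  ℓ * length (cartesianProduct (ball r) (cartesianProduct (ball r) (ball r)))
                                                     ≡⟨ cong (ℓ *_) (length-cartesianProduct (ball r) (cartesianProduct (ball r) (ball r))) ⟩
  ℓ * (ℓ * length (cartesianProduct (ball r) (ball r))) ≡⟨ cong (λ m → ℓ * (ℓ * m)) (length-cartesianProduct (ball r) (ball r)) ⟩
  ℓ * (ℓ * (ℓ * ℓ))                                  ≡⟨ cong (λ m → m * (m * (m * m))) (length-ball r) ⟩
  (suc r + r) * ((suc r + r) * ((suc r + r) * (suc r + r))) ∎
  where
  open ≡-Reasoning
  ℓ = length (ball r)

length-ball⁴≤ : ∀ r → 1 ≤ r → length (ball⁴ r) ≤ 81 * (r * r * (r * r))
length-ball⁴≤ r 1≤r = begin
  length (ball⁴ r)                         ≡⟨ length-ball⁴ r ⟩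
  L * (L * (L * L))                        ≤⟨ *-mono-≤ L≤3r (*-mono-≤ L≤3r (*-mono-≤ L≤3r L≤3r)) ⟩
  3 * r * (3 * r * (3 * r * (3 * r)))      ≡⟨ fourth-power r ⟩
  81 * (r * r * (r * r))                   ∎
  where
  open ≤-Reasoning
  triple : ∀ r → r + r + r ≡ 3 * r
  triple = ℕ-Ring.solve-∀
  fourth-power : ∀ r → 3 * r * (3 * r * (3 * r * (3 * r))) ≡ 81 * (r * r * (r * r))
  fourth-power = ℕ-Ring.solve-∀
  L = suc r + r
  L≤3r : L ≤ 3 * r
  L≤3r = begin
    suc r + r       ≤⟨ +-monoˡ-≤ r (+-monoˡ-≤ r 1≤r) ⟩
    r + r + r       ≡⟨ triple r ⟩
    3 * r           ∎

quotient-square-bound : ∀ K t → (K / suc t) * (K / suc t) ≤ 2 * (K * K) / (suc (suc t) * suc t)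
quotient-square-bound K t = m*n≤o⇒m≤o/n (m * m) (suc s * s) (2 * (K * K)) (begin
  m * m * (suc s * s)         ≤⟨ *-monoʳ-≤ (m * m) (+-monoˡ-≤ (s * s) (m≤m*n s s)) ⟩
  m * m * (s * s + s * s)     ≡⟨ regroup m s ⟩
  2 * ((m * s) * (m * s))     ≤⟨ *-monoʳ-≤ 2 (*-mono-≤ (m/n*n≤m K s) (m/n*n≤m K s)) ⟩
  2 * (K * K)                 ∎)
  where
  open ≤-Reasoning
  s = suc t
  m = K / s
  regroup : ∀ m s → m * m * (s * s + s * s) ≡ 2 * ((m * s) * (m * s))
  regroup = ℕ-Ring.solve-∀

radius : ℕ → ℕ → ℕ
radius K l = ⌊√ K / suc l ⌋

layer : ℕ → ℕ → List Parameter
layer K l = map (suc l ,_) (ball⁴ (radius K l))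

length-layer : ∀ K t → suc t ≤ K → length (layer K t) ≤ 81 * (2 * (K * K) / (suc (suc t) * suc t))
length-layer K t 1+t≤K = begin
  length (layer K t)                       ≡⟨ length-map _ (ball⁴ r) ⟩
  length (ball⁴ r)                         ≤⟨ length-ball⁴≤ r (⌊√⌋-greatest m 1 (m≥n⇒m/n>0 1+t≤K)) ⟩
  81 * (r * r * (r * r))                   ≤⟨ *-monoʳ-≤ 81 (*-mono-≤ r²≤m r²≤m) ⟩
  81 * (m * m)                             ≤⟨ *-monoʳ-≤ 81 (quotient-square-bound K t) ⟩
  81 * (2 * (K * K) / (suc (suc t) * suc t)) ∎
  where
  open ≤-Reasoning
  m = K / suc t
  r = ⌊√ m ⌋
  r²≤m : r * r ≤ m
  r²≤m = proj₁ (⌊√⌋-spec m)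

pronicSum : ℕ → ℕ → ℕ → ℕ
pronicSum Y t zero    = 0
pronicSum Y t (suc c) = Y / (suc (suc t) * suc t) + pronicSum Y (suc t) c

-- Floor-division form of 1/(s(s+1)) = 1/s − 1/(s+1).
pronic-step : ∀ Y t → Y / (suc (suc t) * suc t) + Y / suc (suc t) ≤ Y / suc t
pronic-step Y t = m*n≤o⇒m≤o/n (u + v) s Y (begin
  (u + v) * s      ≡⟨ *-distribʳ-+ s u v ⟩
  u * s + v * s    ≤⟨ +-monoˡ-≤ (v * s) us≤v ⟩
  v + v * s        ≡⟨ *-suc v s ⟨
  v * suc s        ≤⟨ m/n*n≤m Y (suc s) ⟩
  Y                ∎)
  where
  open ≤-Reasoning
  s = suc t
  u = Y / (suc s * s)
  v = Y / suc s
  us≤v : u * s ≤ v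
  us≤v = subst (λ w → w * s ≤ v) (m/n/o≡m/[n*o] Y (suc s) s) (m/n*n≤m v s)

pronicSum≤ : ∀ Y t c → pronicSum Y t c ≤ Y / suc t
pronicSum≤ Y t zero    = z≤n
pronicSum≤ Y t (suc c) =
  ≤-trans (+-monoʳ-≤ (Y / (suc (suc t) * suc t)) (pronicSum≤ Y (suc t) c)) (pronic-step Y t)

parametersFrom : ℕ → ℕ → ℕ → List Parameter
parametersFrom K t zero    = []
parametersFrom K t (suc c) = layer K t ++ parametersFrom K (suc t) c

parameters : ℕ → List Parameter
parameters K = parametersFrom K 0 K

length-parametersFrom : ∀ K t c → t + c ≤ K →
                        length (parametersFrom K t c) ≤ 81 * pronicSum (2 * (K * K)) t c
length-parametersFrom K t zero    _      = z≤n
length-parametersFrom K t (suc c) t+1+c≤K = begin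
  length (layer K t ++ parametersFrom K (suc t) c)                ≡⟨ length-++ (layer K t) {parametersFrom K (suc t) c} ⟩
  length (layer K t) + length (parametersFrom K (suc t) c)        ≤⟨ +-mono-≤ (length-layer K t 1+t≤K)
                                                                       (length-parametersFrom K (suc t) c 1+t+c≤K) ⟩
  81 * (Y / (suc (suc t) * suc t)) + 81 * pronicSum Y (suc t) c   ≡⟨ *-distribˡ-+ 81 (Y / (suc (suc t) * suc t)) (pronicSum Y (suc t) c) ⟨
  81 * pronicSum Y t (suc c)                                      ∎
  where
  open ≤-Reasoning
  Y = 2 * (K * K)
  1+t+c≤K : suc t + c ≤ K
  1+t+c≤K = subst (_≤ K) (+-suc t c) t+1+c≤K
  1+t≤K : suc t ≤ K
  1+t≤K = ≤-trans (m≤m+n (suc t) c) 1+t+c≤K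

length-parameters : ∀ K → length (parameters K) ≤ 162 * (K * K)
length-parameters K = begin
  length (parameters K)              ≤⟨ length-parametersFrom K 0 K ≤-refl ⟩
  81 * pronicSum (2 * (K * K)) 0 K   ≤⟨ *-monoʳ-≤ 81 (pronicSum≤ (2 * (K * K)) 0 K) ⟩
  81 * (2 * (K * K) / 1)             ≡⟨ cong (81 *_) (n/1≡n (2 * (K * K))) ⟩
  81 * (2 * (K * K))                 ≡⟨ *-assoc 81 2 (K * K) ⟨
  162 * (K * K)                      ∎
  where open ≤-Reasoning

∈-ball-radius : ∀ K l x → suc l * ∣ x ∣² ≤ K → x ∈ ball (radius K l)
∈-ball-radius K l x bound =
  ∈-ball (radius K l) x (⌊√⌋-greatest (K / suc l) ∣ x ∣ (m*n≤o⇒m≤o/n ∣ x ∣² (suc l) K (subst (_≤ K) (*-comm (suc l) ∣ x ∣²) bound)))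

∈-parametersFrom : ∀ K t c l v → t ≤ l → l < t + c → v ∈ ball⁴ (radius K l) → (suc l , v) ∈ parametersFrom K t c
∈-parametersFrom K t zero    l v t≤l l<t+0   _  = contradiction (≤-<-trans t≤l (subst (l <_) (+-identityʳ t) l<t+0)) (n≮n t)
∈-parametersFrom K t (suc c) l v t≤l l<t+1+c v∈ with m≤n⇒m<n∨m≡n t≤l
... | inj₂ refl = ∈-++⁺ˡ (∈-map⁺ (suc t ,_) v∈)
... | inj₁ t<l  = ∈-++⁺ʳ (layer K t) (∈-parametersFrom K (suc t) c l v t<l (subst (l <_) (+-suc t c) l<t+1+c) v∈)

zero-parameter : Parameter
zero-parameter = 1 , + 0 , + 0 , + 0 , + 0

zero-parameter∈ : ∀ K → 0 < K → zero-parameter ∈ parameters K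
zero-parameter∈ K 0<K = ∈-parametersFrom K 0 K 0 (+ 0 , + 0 , + 0 , + 0) z≤n 0<K (∈-ball⁴ (radius K 0) 0∈ 0∈ 0∈ 0∈)
  where
  0∈ : + 0 ∈ ball (radius K 0)
  0∈ = ∈-ball (radius K 0) (+ 0) z≤n

zero-entries : ∀ l → entries (l , + 0 , + 0 , + 0 , + 0) ≡ (+ 0 , + 0 , + 0 , + 0)
zero-entries l = cong₂ _,_ l*0≡0 (cong₂ _,_ l*0≡0 (cong₂ _,_ l*0≡0 l*0≡0))
  where
  l*0≡0 : + l ℤ.* + 0 ≡ + 0
  l*0≡0 = ℤP.*-zeroʳ (+ l)

vanishes-at-large-scale : ∀ {K l} x → suc l * ∣ x ∣² ≤ K → K ≤ l → x ≡ + 0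
vanishes-at-large-scale {K} {l} x bound K≤l = ∣∣²≡0⇒≡0 x (small ∣ x ∣² (≤-trans bound K≤l))
  where
  small : ∀ v → suc l * v ≤ l → v ≡ 0
  small zero    _ = refl
  small (suc v) h = contradiction (≤-trans (m≤m*n (suc l) (suc v)) h) (n≮n l)

large-scale-entries : ∀ {K} l a₁ a₂ b₁ b₂ → K ≤ l → Bounded K (suc l , a₁ , a₂ , b₁ , b₂) →
                      entries (suc l , a₁ , a₂ , b₁ , b₂) ≡ (+ 0 , + 0 , + 0 , + 0)
large-scale-entries l a₁ a₂ b₁ b₂ K≤l (h₁ , h₂ , h₃ , h₄)
  rewrite vanishes-at-large-scale a₁ h₁ K≤l | vanishes-at-large-scale a₂ h₂ K≤l
        | vanishes-at-large-scale b₁ h₃ K≤l | vanishes-at-large-scale b₂ h₄ K≤l = zero-entries (suc l)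

-- Scale 0, and scales above K (which force α = β = 0), only give the zero entries,
-- which zero-parameter also produces.
covers : ∀ K p → 0 < K → Bounded K p → ∃[ p′ ] p′ ∈ parameters K × entries p′ ≡ entries p
covers K (zero , _) 0<K _ = zero-parameter , zero-parameter∈ K 0<K , refl
covers K (suc l , a₁ , a₂ , b₁ , b₂) 0<K bounded@(h₁ , h₂ , h₃ , h₄) with l <? K
... | yes l<K = (suc l , a₁ , a₂ , b₁ , b₂) , ∈-parametersFrom K 0 K l (a₁ , a₂ , b₁ , b₂) z≤n l<K a∈ , refl
  where
  a∈ : (a₁ , a₂ , b₁ , b₂) ∈ ball⁴ (radius K l)
  a∈ = ∈-ball⁴ (radius K l) (∈-ball-radius K l a₁ h₁) (∈-ball-radius K l a₂ h₂) (∈-ball-radius K l b₁ h₃) (∈-ball-radius K l b₂ h₄)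
... | no  l≮K = zero-parameter , zero-parameter∈ K 0<K , sym (large-scale-entries l a₁ a₂ b₁ b₂ (≮⇒≥ l≮K) bounded)

∈-boxQuadruples⁻ : ∀ n {a b c d} → (a , b , c , d) ∈ boxQuadruples n → a ≤ n × b ≤ n × c ≤ n × d ≤ n
∈-boxQuadruples⁻ n q∈
  with a∈ , bcd∈ ← ∈-cartesianProduct⁻ (upTo (suc n)) (cartesianProduct (upTo (suc n)) (cartesianProduct (upTo (suc n)) (upTo (suc n)))) q∈
  with b∈ , cd∈  ← ∈-cartesianProduct⁻ (upTo (suc n)) (cartesianProduct (upTo (suc n)) (upTo (suc n))) bcd∈
  with c∈ , d∈   ← ∈-cartesianProduct⁻ (upTo (suc n)) (upTo (suc n)) cd∈
  = ≤-pred (∈-upTo⁻ a∈) , ≤-pred (∈-upTo⁻ b∈) , ≤-pred (∈-upTo⁻ c∈) , ≤-pred (∈-upTo⁻ d∈)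

Unique-triangleQuadruples : ∀ n → Unique (filter isTriangleQuadruple? (boxQuadruples n))
Unique-triangleQuadruples n =
  Unique.filter⁺ isTriangleQuadruple? (Unique.cartesianProduct⁺ u (Unique.cartesianProduct⁺ u (Unique.cartesianProduct⁺ u u)))
  where
  u : Unique (upTo (suc n))
  u = Unique.upTo⁺ (suc n)

triangleQuadruples⊆ : ∀ n → 0 < n →
                      filter isTriangleQuadruple? (boxQuadruples n) ⊆ map (decode ∘ entries) (parameters (4 * n))
triangleQuadruples⊆ n 0<n {q@(a , b , c , d)} q∈ = represented (triangle-parameter n a b c d a≤n d≤n isT)
  where
  filtered : q ∈ boxQuadruples n × IsTriangleQuadruple q
  filtered = ∈-filter⁻ isTriangleQuadruple? {xs = boxQuadruples n} q∈
  isT : IsTriangleQuadruple q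
  isT = proj₂ filtered
  bounds : a ≤ n × b ≤ n × c ≤ n × d ≤ n
  bounds = ∈-boxQuadruples⁻ n (proj₁ filtered)
  a≤n : a ≤ n
  a≤n = proj₁ bounds
  d≤n : d ≤ n
  d≤n = proj₂ (proj₂ (proj₂ bounds))
  represented : ∃[ p ] Bounded (4 * n) p × decode (entries p) ≡ q → q ∈ map (decode ∘ entries) (parameters (4 * n))
  represented (p , bounded , decoded) with p′ , p′∈ , same-entries ← covers (4 * n) p (≤-trans 0<n (m≤n*m n 4)) bounded
    = subst (_∈ map (decode ∘ entries) (parameters (4 * n))) (trans (cong decode same-entries) decoded)
            (∈-map⁺ (decode ∘ entries) p′∈)

countTriangleQuadruples≤ : ∀ n → 0 < n → countTriangleQuadruples n ≤ 2592 * n ^ 2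
countTriangleQuadruples≤ n 0<n = begin
  countTriangleQuadruples n                              ≤⟨ Unique-⊆⇒length≤ (Unique-triangleQuadruples n) (triangleQuadruples⊆ n 0<n) ⟩
  length (map (decode ∘ entries) (parameters (4 * n)))   ≡⟨ length-map (decode ∘ entries) (parameters (4 * n)) ⟩
  length (parameters (4 * n))                            ≤⟨ length-parameters (4 * n) ⟩
  162 * (4 * n * (4 * n))                                ≡⟨ regroup n ⟩
  2592 * n ^ 2                                           ∎
  where
  open ≤-Reasoning
  -- n ^ 2 unfolds to n * (n * 1); the solver is given the unfolded form.
  regroup : ∀ n → 162 * (4 * n * (4 * n)) ≡ 2592 * (n * (n * 1))
  regroup = ℕ-Ring.solve-∀

theorem3 : ∃[ C ] ∃[ N ] (∀ (n : ℕ) → N ≤ n →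
    countTriangleQuadruples n ≤ C * (n ^ 2 * ⌊log₂ n ⌋ ^ 3))
theorem3 = 2592 , 2 , λ n 2≤n → begin
  countTriangleQuadruples n          ≤⟨ countTriangleQuadruples≤ n (≤-trans (s≤s z≤n) 2≤n) ⟩
  2592 * n ^ 2                       ≡⟨ cong (2592 *_) (*-identityʳ (n ^ 2)) ⟨
  2592 * (n ^ 2 * 1 ^ 3)             ≤⟨ *-monoʳ-≤ 2592 (*-monoʳ-≤ (n ^ 2) (^-monoˡ-≤ 3 (⌊log₂⌋-mono-≤ 2≤n))) ⟩
  2592 * (n ^ 2 * ⌊log₂ n ⌋ ^ 3)     ∎
  where open ≤-Reasoning
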